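{- Let $G=(V,E)$ be a finite simple undirected graph with maximum degree $\Delta(G)$. Let $V_{max}$ be the set of vertices of degree $\Delta(G)$, and partition $V_{max}=V_1\cup\dots\cup V_m$ into the equivalence classes of the relation $x\equiv y \iff N_G(x)=N_G(y)$. For $i\in[m]$ let $N_i$ be the common closed neighborhood of the vertices in $V_i$ and $V_i'=N_i\setminus V_i$. Then $\mathrm{VCD}(\mathcal{C}_{star}(G))=\Delta(G)+1$ if and only if there exist an index $i\in[m]$ and a vertex $v\notin N_i$ such that $V_i'\subseteq N_G(v)$.
   Context: $N_G^o(x)=\{y:\{x,y\}\in E\}$ is the open neighborhood and $N_G(x)=N_G^o(x)\cup\{x\}$ the closed neighborhood of $x$. The concept class $\mathcal{C}_{star}(G)$ over domain $V$ is $\{X\cup\{x\} : x\in V,\ X\subseteq N_G^o(x)\}$. A set $S\subseteq V$ is shattered by a class $\mathcal{C}$ if for every $S'\subseteq S$ there is $C\in\mathcal{C}$ with $S\cap C=S'$; $\mathrm{VCD}(\mathcal{C})$ is the largest size of a shattered set. -}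

module Defs where

open import Data.Nat using (ℕ; _≤_; _⊔_; _+_)
open import Data.Bool using (Bool; true; false)
open import Data.Fin using (Fin)
open import Data.Fin.Subset using (Subset; _∈_; _∉_; _⊆_; _∪_; _∩_; ⁅_⁆; ∣_∣)
open import Data.Vec using (tabulate)
open import Data.List using (foldr; map; allFin)
open import Data.Product using (Σ; _×_; ∃; ∃-syntax)
open import Relation.Binary.PropositionalEquality using (_≡_)
open import Relation.Nullary using (¬_)

record Graph (n : ℕ) : Set where
  field
    adj   : Fin n → Fin n → Bool
    sym   : ∀ x y → adj x y ≡ adj y x
    irrfl : ∀ x → adj x x ≡ false
open Graph public

module _ {n : ℕ} (G : Graph n) where

  Nᵒ : Fin n → Subset n
  Nᵒ x = tabulate (adj G x)

  Nc : Fin n → Subset n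
  Nc x = Nᵒ x ∪ ⁅ x ⁆

  deg : Fin n → ℕ
  deg x = ∣ Nᵒ x ∣

  Δ : ℕ
  Δ = foldr _⊔_ 0 (map deg (allFin n))

  Cstar : Subset n → Set
  Cstar C = ∃[ x ] ∃[ X ] (X ⊆ Nᵒ x × C ≡ X ∪ ⁅ x ⁆)

  -- y lies in the ≡-class of x inside V_max (same closed neighbourhood, degree Δ)
  InClass : Fin n → Fin n → Set
  InClass x y = deg y ≡ Δ × Nc y ≡ Nc x

module _ {n : ℕ} (𝒞 : Subset n → Set) where

  Shattered : Subset n → Set
  Shattered S = ∀ S' → S' ⊆ S → ∃[ C ] (𝒞 C × S ∩ C ≡ S')

  IsVCD : ℕ → Set
  IsVCD d = (∃[ S ] (Shattered S × ∣ S ∣ ≡ d)) × (∀ S → Shattered S → ∣ S ∣ ≤ d)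

-- Every concept X ∪ {y} lies inside the closed neighbourhood N(y), so a shattered set lies in
-- some N(x) and has at most Δ + 1 elements; a shattered set of size Δ + 1 must be N(x) with
-- deg x = Δ. A subset S' ⊆ N(x) meeting the class of x is cut out by the star centred at a
-- class member in S', whose closed neighbourhood is N(x). The remaining subset Vᵢ' (N(x) minus
-- the class) must be cut out by a star centred at some v ∉ N(x) with Vᵢ' ⊆ N(v): a centre y
-- inside N(x) would satisfy N(x) ⊆ N(y) (class members see y through their neighbourhood N(x)),
-- which by maximality of deg x would put y in the class of x.
module Submission where

open import Defs
open import Data.Empty using (⊥-elim)
open import Data.Fin using (Fin; zero; suc)
open import Data.Fin.Properties using (any?)
open import Data.Fin.Subset
  using (Subset; Side; inside; outside; _∈_; _∉_; _⊆_; _∪_; _∩_; ⁅_⁆; ∣_∣)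
open import Data.Fin.Subset.Properties
  using ( _∈?_; x∈⁅x⁆; x∈⁅y⁆⇒x≡y; x∈p∪q⁺; x∈p∪q⁻; x∈p∩q⁺; x∈p∩q⁻; p∩q⊆q
        ; ⊆-antisym; p⊆q⇒∣p∣≤∣q∣; p⊂q⇒∣p∣<∣q∣; ∪-identityʳ)
open import Data.List using (List; _∷_; foldr)
import Data.List.Membership.Propositional as List
open import Data.List.Membership.Propositional.Properties using (∈-map⁺; ∈-allFin)
open import Data.List.Relation.Unary.Any using (here; there)
open import Data.Nat using (ℕ; suc; _+_; _≤_; _⊔_; s≤s)
open import Data.Nat.Properties
  using (≤-refl; ≤-trans; ≤-antisym; <⇒≱; n≤1+n; m≤m⊔n; m≤n⇒m≤o⊔n; +-comm; ≤-pred)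
import Data.Nat.Properties as ℕ
open import Data.Product using (_×_; _,_; proj₁; proj₂; uncurry; ∃-syntax)
open import Data.Sum using (_⊎_; inj₁; inj₂; fromInj₁)
open import Data.Vec using (_∷_; tabulate)
open import Data.Vec.Properties using (lookup∘tabulate; []=⇒lookup; lookup⇒[]=; ≡-dec)
import Data.Bool.Properties as Bool
open import Function using (_∘_)
open import Function.Bundles using (_⇔_; mk⇔)
open import Relation.Nullary using (¬_; yes; no; does; ¬?; _×-dec_)
open import Relation.Nullary.Decidable using (dec-true)
open import Relation.Unary using (Pred; Decidable)
open import Relation.Binary.PropositionalEquality as ≡
  using (_≡_; refl; trans; subst; subst₂)

≤-foldr-⊔ : ∀ {y} {xs : List ℕ} → y List.∈ xs → y ≤ foldr _⊔_ 0 xs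
≤-foldr-⊔ {xs = x ∷ _} (here refl)  = m≤m⊔n x _
≤-foldr-⊔ {xs = x ∷ _} (there y∈xs) = m≤n⇒m≤o⊔n x (≤-foldr-⊔ y∈xs)

x∈tabulate⁻ : ∀ {n} {f : Fin n → Side} {x} → x ∈ tabulate f → f x ≡ inside
x∈tabulate⁻ {f = f} {x} x∈ = trans (≡.sym (lookup∘tabulate f x)) ([]=⇒lookup x∈)

x∈tabulate⁺ : ∀ {n} {f : Fin n → Side} {x} → f x ≡ inside → x ∈ tabulate f
x∈tabulate⁺ {f = f} {x} fx = lookup⇒[]= x (tabulate f) (trans (lookup∘tabulate f x) fx)

∣p∪⁅x⁆∣≤1+∣p∣ : ∀ {n} (p : Subset n) x → ∣ p ∪ ⁅ x ⁆ ∣ ≤ suc ∣ p ∣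
∣p∪⁅x⁆∣≤1+∣p∣ (inside  ∷ p) zero rewrite ∪-identityʳ p = n≤1+n _
∣p∪⁅x⁆∣≤1+∣p∣ (outside ∷ p) zero rewrite ∪-identityʳ p = ≤-refl
∣p∪⁅x⁆∣≤1+∣p∣ (inside  ∷ p) (suc x) = s≤s (∣p∪⁅x⁆∣≤1+∣p∣ p x)
∣p∪⁅x⁆∣≤1+∣p∣ (outside ∷ p) (suc x) = ∣p∪⁅x⁆∣≤1+∣p∣ p x

p⊆q∧∣q∣≤∣p∣⇒p≡q : ∀ {n} {p q : Subset n} → p ⊆ q → ∣ q ∣ ≤ ∣ p ∣ → p ≡ q
p⊆q∧∣q∣≤∣p∣⇒p≡q {p = p} p⊆q ∣q∣≤∣p∣ = ⊆-antisym p⊆q q⊆p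
  where
  q⊆p : _ ⊆ p
  q⊆p {x} x∈q with x ∈? p
  ... | yes x∈p = x∈p
  ... | no  x∉p = ⊥-elim (<⇒≱ (p⊂q⇒∣p∣<∣q∣ (p⊆q , x , x∈q , x∉p)) ∣q∣≤∣p∣)

p∩q≡r⇒r⊆q : ∀ {n} {p q r : Subset n} → p ∩ q ≡ r → r ⊆ q
p∩q≡r⇒r⊆q {p = p} {q} refl = p∩q⊆q p q

module _ {n ℓ} {P : Pred (Fin n) ℓ} where

  ⟦_⟧ : Decidable P → Subset n
  ⟦ P? ⟧ = tabulate (does ∘ P?)

  ∈⟦⟧⁺ : (P? : Decidable P) → ∀ {x} → P x → x ∈ ⟦ P? ⟧
  ∈⟦⟧⁺ P? {x} px = x∈tabulate⁺ (dec-true (P? x) px)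

  ∈⟦⟧⁻ : (P? : Decidable P) → ∀ {x} → x ∈ ⟦ P? ⟧ → P x
  ∈⟦⟧⁻ P? {x} x∈ with P? x | x∈tabulate⁻ {f = does ∘ P?} x∈
  ... | yes px | _ = px

module _ {n : ℕ} (G : Graph n) where

  x∉Nᵒx : ∀ x → x ∉ Nᵒ G x
  x∉Nᵒx x x∈ with trans (≡.sym (irrfl G x)) (x∈tabulate⁻ x∈)
  ... | ()

  x∈Ncx : ∀ x → x ∈ Nc G x
  x∈Ncx x = x∈p∪q⁺ (inj₂ (x∈⁅x⁆ x))

  Nc-sym : ∀ {x y} → y ∈ Nc G x → x ∈ Nc G y
  Nc-sym {x} {y} y∈ with x∈p∪q⁻ (Nᵒ G x) ⁅ x ⁆ y∈
  ... | inj₁ y∈Nᵒ = x∈p∪q⁺ (inj₁ (x∈tabulate⁺ (trans (Graph.sym G y x) (x∈tabulate⁻ y∈Nᵒ))))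
  ... | inj₂ y∈⁅x⁆ rewrite x∈⁅y⁆⇒x≡y x y∈⁅x⁆ = x∈Ncx x

  deg≤Δ : ∀ x → deg G x ≤ Δ G
  deg≤Δ x = ≤-foldr-⊔ (∈-map⁺ (deg G) (∈-allFin x))

  ∣Nc∣≡1+deg : ∀ x → ∣ Nc G x ∣ ≡ suc (deg G x)
  ∣Nc∣≡1+deg x = ≤-antisym (∣p∪⁅x⁆∣≤1+∣p∣ (Nᵒ G x) x)
    (p⊂q⇒∣p∣<∣q∣ (x∈p∪q⁺ ∘ inj₁ , x , x∈Ncx x , x∉Nᵒx x))

  ∣Nc∣≤1+Δ : ∀ x → ∣ Nc G x ∣ ≤ suc (Δ G)
  ∣Nc∣≤1+Δ x = subst (_≤ suc (Δ G)) (≡.sym (∣Nc∣≡1+deg x)) (s≤s (deg≤Δ x))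

  S⊆Nc∧∣S∣≡1+Δ⇒S≡Nc : ∀ {S x} → S ⊆ Nc G x → ∣ S ∣ ≡ suc (Δ G) → deg G x ≡ Δ G × S ≡ Nc G x
  S⊆Nc∧∣S∣≡1+Δ⇒S≡Nc {S} {x} S⊆Nc ∣S∣ = degx≡Δ , p⊆q∧∣q∣≤∣p∣⇒p≡q S⊆Nc ∣Nc∣≤∣S∣
    where
    1+Δ≤1+deg : suc (Δ G) ≤ suc (deg G x)
    1+Δ≤1+deg = subst₂ _≤_ ∣S∣ (∣Nc∣≡1+deg x) (p⊆q⇒∣p∣≤∣q∣ S⊆Nc)
    degx≡Δ : deg G x ≡ Δ G
    degx≡Δ = ≤-antisym (deg≤Δ x) (≤-pred 1+Δ≤1+deg)
    ∣Nc∣≤∣S∣ : ∣ Nc G x ∣ ≤ ∣ S ∣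
    ∣Nc∣≤∣S∣ = subst (∣ Nc G x ∣ ≤_) (≡.sym ∣S∣) (∣Nc∣≤1+Δ x)

  ∣Nc∣≡1+Δ : ∀ {x} → deg G x ≡ Δ G → ∣ Nc G x ∣ ≡ suc (Δ G)
  ∣Nc∣≡1+Δ {x} degx≡Δ = trans (∣Nc∣≡1+deg x) (≡.cong suc degx≡Δ)

  Nc⊆Nc⇒InClass : ∀ {x y} → deg G x ≡ Δ G → Nc G x ⊆ Nc G y → InClass G x y
  Nc⊆Nc⇒InClass degx≡Δ Ncx⊆Ncy with S⊆Nc∧∣S∣≡1+Δ⇒S≡Nc Ncx⊆Ncy (∣Nc∣≡1+Δ degx≡Δ)
  ... | degy≡Δ , Ncx≡Ncy = degy≡Δ , ≡.sym Ncx≡Ncy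

  InClass? : ∀ x → Decidable (InClass G x)
  InClass? x y = (deg G y ℕ.≟ Δ G) ×-dec ≡-dec Bool._≟_ (Nc G y) (Nc G x)

  outsideClass? : ∀ x → Decidable (λ y → y ∈ Nc G x × ¬ InClass G x y)
  outsideClass? x y = y ∈? Nc G x ×-dec ¬? (InClass? x y)

  -- The paper's Vᵢ' = Nᵢ ∖ Vᵢ, for the class Vᵢ of x.
  outsideClass : Fin n → Subset n
  outsideClass x = ⟦ outsideClass? x ⟧

  star⊆Nc : ∀ {X y} → X ⊆ Nᵒ G y → X ∪ ⁅ y ⁆ ⊆ Nc G y
  star⊆Nc {X} {y} X⊆Nᵒ x∈ with x∈p∪q⁻ X ⁅ y ⁆ x∈
  ... | inj₁ x∈X    = x∈p∪q⁺ (inj₁ (X⊆Nᵒ x∈X))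
  ... | inj₂ x∈⁅y⁆ = x∈p∪q⁺ (inj₂ x∈⁅y⁆)

  shattered⊆Nc : ∀ {S} → Shattered (Cstar G) S → ∃[ x ] S ⊆ Nc G x
  shattered⊆Nc {S} sh with sh S (λ x∈S → x∈S)
  ... | _ , (y , _ , X⊆Nᵒ , refl) , S∩C≡S = y , star⊆Nc X⊆Nᵒ ∘ p∩q≡r⇒r⊆q S∩C≡S

  ∣shattered∣≤Δ+1 : ∀ S → Shattered (Cstar G) S → ∣ S ∣ ≤ Δ G + 1
  ∣shattered∣≤Δ+1 S sh with shattered⊆Nc sh
  ... | x , S⊆Nc rewrite +-comm (Δ G) 1 = ≤-trans (p⊆q⇒∣p∣≤∣q∣ S⊆Nc) (∣Nc∣≤1+Δ x)

  star-cuts : ∀ {S S'} y → S' ⊆ S → S' ⊆ Nc G y → y ∈ S' ⊎ y ∉ S →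
              ∃[ C ] (Cstar G C × S ∩ C ≡ S')
  star-cuts {S} {S'} y S'⊆S S'⊆Nc y∈S'⊎y∉S =
    C , (y , S' ∩ Nᵒ G y , proj₂ ∘ x∈p∩q⁻ S' _ , refl) , ⊆-antisym S∩C⊆S' S'⊆S∩C
    where
    C = (S' ∩ Nᵒ G y) ∪ ⁅ y ⁆
    S∩C⊆S' : S ∩ C ⊆ S'
    S∩C⊆S' x∈ with x∈p∩q⁻ S C x∈
    ... | x∈S , x∈C with x∈p∪q⁻ (S' ∩ Nᵒ G y) ⁅ y ⁆ x∈C
    ... | inj₁ x∈S'∩Nᵒ = proj₁ (x∈p∩q⁻ S' _ x∈S'∩Nᵒ)
    ... | inj₂ x∈⁅y⁆ rewrite x∈⁅y⁆⇒x≡y y x∈⁅y⁆ = fromInj₁ (λ y∉S → ⊥-elim (y∉S x∈S)) y∈S'⊎y∉S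
    S'⊆S∩C : S' ⊆ S ∩ C
    S'⊆S∩C x∈S' with x∈p∪q⁻ (Nᵒ G y) ⁅ y ⁆ (S'⊆Nc x∈S')
    ... | inj₁ x∈Nᵒ  = x∈p∩q⁺ (S'⊆S x∈S' , x∈p∪q⁺ (inj₁ (x∈p∩q⁺ (x∈S' , x∈Nᵒ))))
    ... | inj₂ x∈⁅y⁆ = x∈p∩q⁺ (S'⊆S x∈S' , x∈p∪q⁺ (inj₂ x∈⁅y⁆))

  outsideClass⊆Nc⇒Nc-shattered : ∀ {x v} → v ∉ Nc G x → outsideClass x ⊆ Nc G v →
                                  Shattered (Cstar G) (Nc G x)
  outsideClass⊆Nc⇒Nc-shattered {x} {v} v∉Nc outside⊆Ncv S' S'⊆Nc
    with any? (λ z → z ∈? S' ×-dec InClass? x z)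
  ... | yes (z , z∈S' , _ , Ncz≡Ncx) =
    star-cuts z S'⊆Nc (subst (λ T → S' ⊆ T) (≡.sym Ncz≡Ncx) S'⊆Nc) (inj₁ z∈S')
  ... | no ∄z = star-cuts v S'⊆Nc S'⊆Ncv (inj₂ v∉Nc)
    where
    S'⊆Ncv : S' ⊆ Nc G v
    S'⊆Ncv {y} y∈S' =
      outside⊆Ncv (∈⟦⟧⁺ (outsideClass? x) (S'⊆Nc y∈S' , λ class → ∄z (y , y∈S' , class)))

  cuts-outsideClass⇒centre∉Nc : ∀ {x y X} → deg G x ≡ Δ G → X ⊆ Nᵒ G y →
                                Nc G x ∩ (X ∪ ⁅ y ⁆) ≡ outsideClass x → y ∉ Nc G x
  cuts-outsideClass⇒centre∉Nc {x} {y} {X} degx≡Δ X⊆Nᵒ cut y∈Nc =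
    y∉class (Nc⊆Nc⇒InClass degx≡Δ Ncx⊆Ncy)
    where
    outside⊆Ncy : outsideClass x ⊆ Nc G y
    outside⊆Ncy = star⊆Nc X⊆Nᵒ ∘ p∩q≡r⇒r⊆q cut
    y∉class : ¬ InClass G x y
    y∉class = proj₂ (∈⟦⟧⁻ (outsideClass? x) (subst (y ∈_) cut y∈Nc∩star))
      where
      y∈Nc∩star : y ∈ Nc G x ∩ (X ∪ ⁅ y ⁆)
      y∈Nc∩star = x∈p∩q⁺ (y∈Nc , x∈p∪q⁺ (inj₂ (x∈⁅x⁆ y)))
    Ncx⊆Ncy : Nc G x ⊆ Nc G y
    Ncx⊆Ncy {z} z∈Nc with InClass? x z
    ... | yes (_ , Ncz≡Ncx) = Nc-sym (subst (y ∈_) (≡.sym Ncz≡Ncx) y∈Nc)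
    ... | no  z∉class       = outside⊆Ncy (∈⟦⟧⁺ (outsideClass? x) (z∈Nc , z∉class))

  Nc-shattered⇒outsideClass⊆Nc : ∀ {x} → deg G x ≡ Δ G → Shattered (Cstar G) (Nc G x) →
                                  ∃[ v ] (v ∉ Nc G x × outsideClass x ⊆ Nc G v)
  Nc-shattered⇒outsideClass⊆Nc {x} degx≡Δ sh
    with sh (outsideClass x) (proj₁ ∘ ∈⟦⟧⁻ (outsideClass? x))
  ... | _ , (y , _ , X⊆Nᵒ , refl) , cut =
    y , cuts-outsideClass⇒centre∉Nc degx≡Δ X⊆Nᵒ cut , star⊆Nc X⊆Nᵒ ∘ p∩q≡r⇒r⊆q cut

theorem3 : ∀ {n : ℕ} (G : Graph n) →
    IsVCD (Cstar G) (Δ G + 1)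
      ⇔ (∃[ x ] (deg G x ≡ Δ G × (∃[ v ] (v ∉ Nc G x ×
           (∀ y → y ∈ Nc G x → ¬ InClass G x y → y ∈ Nc G v)))))
theorem3 G = mk⇔ forward backward
  where
  RHS : Set
  RHS = ∃[ x ] (deg G x ≡ Δ G × (∃[ v ] (v ∉ Nc G x ×
          (∀ y → y ∈ Nc G x → ¬ InClass G x y → y ∈ Nc G v))))

  forward : IsVCD (Cstar G) (Δ G + 1) → RHS
  forward ((S , sh , ∣S∣≡Δ+1) , _) with shattered⊆Nc G sh
  ... | x , S⊆Nc with S⊆Nc∧∣S∣≡1+Δ⇒S≡Nc G S⊆Nc (trans ∣S∣≡Δ+1 (+-comm (Δ G) 1))
  ... | degx≡Δ , refl with Nc-shattered⇒outsideClass⊆Nc G degx≡Δ sh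
  ... | v , v∉Nc , outside⊆Ncv =
    x , degx≡Δ , v , v∉Nc ,
    λ _ y∈Nc y∉class → outside⊆Ncv (∈⟦⟧⁺ (outsideClass? G x) (y∈Nc , y∉class))

  backward : RHS → IsVCD (Cstar G) (Δ G + 1)
  backward (x , degx≡Δ , v , v∉Nc , outside⊆Ncv) =
    (Nc G x , outsideClass⊆Nc⇒Nc-shattered G v∉Nc outside⊆Ncv′ , ∣Nc∣≡Δ+1) , ∣shattered∣≤Δ+1 G
    where
    outside⊆Ncv′ : outsideClass G x ⊆ Nc G v
    outside⊆Ncv′ = uncurry (outside⊆Ncv _) ∘ ∈⟦⟧⁻ (outsideClass? G x)
    ∣Nc∣≡Δ+1 : ∣ Nc G x ∣ ≡ Δ G + 1
    ∣Nc∣≡Δ+1 = trans (∣Nc∣≡1+Δ G degx≡Δ) (+-comm 1 (Δ G))
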